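{- Let $M,N:\sigma$ be closed $\lambda\Omega^+$ terms with $\mathcal{O}[\![M]\!]=\mathcal{O}[\![N]\!]$. Then $M$ has a proper normal form if and only if $N$ has a proper normal form.
   Context: Simple types are built from a ground type $o$ with $\to$. The $\lambda\Omega^+$-calculus is the typed (Church-style) $\lambda\beta\eta$-calculus extended with constants $\Omega_\sigma:\sigma$ for every type $\sigma$, with no additional conversion rules. A long $\beta\eta$-normal form is proper if it contains no constant $\Omega_\sigma$; a term has a proper normal form if its long $\beta\eta$-normal form is proper. Semantics: $\mathcal{O}_o=\{\perp,\top\}$ with $\perp\le\top$, $\mathcal{O}_{\sigma\to\tau}$ is the poset of monotone functions ordered pointwise; terms are interpreted in the standard way with $\mathcal{O}[\![\Omega_\sigma]\!]=\perp_{\mathcal{O}_\sigma}$. -}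

module Defs where

open import Data.Bool using (Bool; true; false)
open import Data.Unit using (⊤; tt)
open import Data.Empty using (⊥)
open import Data.List using (List; []; _∷_)
open import Data.Product using (Σ; _×_; _,_; proj₁; proj₂)
open import Relation.Binary.PropositionalEquality using (_≡_)

infixr 7 _⇒_
data Ty : Set where
  o   : Ty
  _⇒_ : Ty → Ty → Ty

Ctx : Set
Ctx = List Ty

infix 4 _∋_
data _∋_ : Ctx → Ty → Set where
  here  : ∀ {Γ σ} → (σ ∷ Γ) ∋ σ
  there : ∀ {Γ σ τ} → Γ ∋ σ → (τ ∷ Γ) ∋ σ

data Tm (Γ : Ctx) : Ty → Set where
  var : ∀ {σ} → Γ ∋ σ → Tm Γ σ
  lam : ∀ {σ τ} → Tm (σ ∷ Γ) τ → Tm Γ (σ ⇒ τ)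
  app : ∀ {σ τ} → Tm Γ (σ ⇒ τ) → Tm Γ σ → Tm Γ τ
  Ω   : (σ : Ty) → Tm Γ σ

Ren : Ctx → Ctx → Set
Ren Γ Δ = ∀ {σ} → Γ ∋ σ → Δ ∋ σ

ext : ∀ {Γ Δ τ} → Ren Γ Δ → Ren (τ ∷ Γ) (τ ∷ Δ)
ext ρ here      = here
ext ρ (there x) = there (ρ x)

rename : ∀ {Γ Δ σ} → Ren Γ Δ → Tm Γ σ → Tm Δ σ
rename ρ (var x)   = var (ρ x)
rename ρ (lam t)   = lam (rename (ext ρ) t)
rename ρ (app t u) = app (rename ρ t) (rename ρ u)
rename ρ (Ω σ)     = Ω σ

Sub : Ctx → Ctx → Set
Sub Γ Δ = ∀ {σ} → Γ ∋ σ → Tm Δ σ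

exts : ∀ {Γ Δ τ} → Sub Γ Δ → Sub (τ ∷ Γ) (τ ∷ Δ)
exts s here      = var here
exts s (there x) = rename there (s x)

subst : ∀ {Γ Δ σ} → Sub Γ Δ → Tm Γ σ → Tm Δ σ
subst s (var x)   = s x
subst s (lam t)   = lam (subst (exts s) t)
subst s (app t u) = app (subst s t) (subst s u)
subst s (Ω σ)     = Ω σ

single : ∀ {Γ σ} → Tm Γ σ → Sub (σ ∷ Γ) Γ
single u here      = u
single u (there x) = var x

_[_] : ∀ {Γ σ τ} → Tm (σ ∷ Γ) τ → Tm Γ σ → Tm Γ τ
t [ u ] = subst (single u) t

-- βη-conversion (no extra rules for the constants Ω)

infix 4 _≡βη_
data _≡βη_ {Γ : Ctx} : ∀ {σ} → Tm Γ σ → Tm Γ σ → Set where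
  β      : ∀ {σ τ} (t : Tm (σ ∷ Γ) τ) (u : Tm Γ σ) → app (lam t) u ≡βη t [ u ]
  η      : ∀ {σ τ} (t : Tm Γ (σ ⇒ τ)) → t ≡βη lam (app (rename there t) (var here))
  refl   : ∀ {σ} {t : Tm Γ σ} → t ≡βη t
  sym    : ∀ {σ} {t u : Tm Γ σ} → t ≡βη u → u ≡βη t
  trans  : ∀ {σ} {t u v : Tm Γ σ} → t ≡βη u → u ≡βη v → t ≡βη v
  ξ      : ∀ {σ τ} {t u : Tm (σ ∷ Γ) τ} → t ≡βη u → lam t ≡βη lam u
  appc   : ∀ {σ τ} {t t' : Tm Γ (σ ⇒ τ)} {u u' : Tm Γ σ} →
           t ≡βη t' → u ≡βη u' → app t u ≡βη app t' u'

-- Long βη-normal forms: neutral terms (head a variable or a constant Ω)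
-- appear only at ground type o.

mutual
  data Nf (Γ : Ctx) : Ty → Set where
    lam : ∀ {σ τ} → Nf (σ ∷ Γ) τ → Nf Γ (σ ⇒ τ)
    ne  : Ne Γ o → Nf Γ o

  data Ne (Γ : Ctx) : Ty → Set where
    var : ∀ {σ} → Γ ∋ σ → Ne Γ σ
    Ω   : (σ : Ty) → Ne Γ σ
    app : ∀ {σ τ} → Ne Γ (σ ⇒ τ) → Nf Γ σ → Ne Γ τ

mutual
  ⌜_⌝ : ∀ {Γ σ} → Nf Γ σ → Tm Γ σ
  ⌜ lam n ⌝ = lam ⌜ n ⌝
  ⌜ ne m ⌝  = ⌜ m ⌝ne

  ⌜_⌝ne : ∀ {Γ σ} → Ne Γ σ → Tm Γ σ
  ⌜ var x ⌝ne   = var x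
  ⌜ Ω σ ⌝ne     = Ω σ
  ⌜ app m n ⌝ne = app ⌜ m ⌝ne ⌜ n ⌝

mutual
  ProperNf : ∀ {Γ σ} → Nf Γ σ → Set
  ProperNf (lam n) = ProperNf n
  ProperNf (ne m)  = ProperNe m

  ProperNe : ∀ {Γ σ} → Ne Γ σ → Set
  ProperNe (var x)   = ⊤
  ProperNe (Ω σ)     = ⊥
  ProperNe (app m n) = ProperNe m × ProperNf n

-- M has a proper normal form: its long βη-normal form is proper.
-- (Long βη-normal forms are unique, so this is the existential reading.)
HasProperNF : ∀ {Γ σ} → Tm Γ σ → Set
HasProperNF {Γ} {σ} M = Σ (Nf Γ σ) λ n → ProperNf n × (M ≡βη ⌜ n ⌝)

mutual
  O : Ty → Set
  O o       = Bool
  O (σ ⇒ τ) = Σ (O σ → O τ) λ f → ∀ {x y} → Le σ x y → Le τ (f x) (f y)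

  Le : (σ : Ty) → O σ → O σ → Set
  Le o false _       = ⊤
  Le o true true     = ⊤
  Le o true false    = ⊥
  Le (σ ⇒ τ) f g     = ∀ x → Le τ (proj₁ f x) (proj₁ g x)

Le-refl : ∀ σ (x : O σ) → Le σ x x
Le-refl o false   = tt
Le-refl o true    = tt
Le-refl (σ ⇒ τ) f = λ x → Le-refl τ (proj₁ f x)

Le-trans : ∀ σ {x y z : O σ} → Le σ x y → Le σ y z → Le σ x z
Le-trans o {false} p q = tt
Le-trans o {true} {true} {true} p q = tt
Le-trans o {true} {true} {false} p ()
Le-trans o {true} {false} () q
Le-trans (σ ⇒ τ) p q = λ x → Le-trans τ (p x) (q x)

bot : ∀ σ → O σ
bot o       = false
bot (σ ⇒ τ) = (λ _ → bot τ) , (λ _ → Le-refl τ (bot τ))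

SemEq : (σ : Ty) → O σ → O σ → Set
SemEq o x y       = x ≡ y
SemEq (σ ⇒ τ) f g = ∀ x → SemEq τ (proj₁ f x) (proj₁ g x)

data Env : Ctx → Set where
  []  : Env []
  _∷_ : ∀ {σ Γ} → O σ → Env Γ → Env (σ ∷ Γ)

data LeEnv : ∀ {Γ} → Env Γ → Env Γ → Set where
  []  : LeEnv [] []
  _∷_ : ∀ {σ Γ} {x y : O σ} {ρ ρ' : Env Γ} → Le σ x y → LeEnv ρ ρ' → LeEnv (x ∷ ρ) (y ∷ ρ')

LeEnv-refl : ∀ {Γ} (ρ : Env Γ) → LeEnv ρ ρ
LeEnv-refl []      = []
LeEnv-refl (_∷_ {σ} x ρ) = Le-refl σ x ∷ LeEnv-refl ρ

lookupEnv : ∀ {Γ σ} → Env Γ → Γ ∋ σ → O σ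
lookupEnv (x ∷ ρ) here      = x
lookupEnv (x ∷ ρ) (there v) = lookupEnv ρ v

lookup-mono : ∀ {Γ σ} {ρ ρ' : Env Γ} → LeEnv ρ ρ' → (v : Γ ∋ σ) →
              Le σ (lookupEnv ρ v) (lookupEnv ρ' v)
lookup-mono (p ∷ _) here      = p
lookup-mono (_ ∷ q) (there v) = lookup-mono q v

-- standard interpretation, with ⟦ Ω σ ⟧ = ⊥ ; monotonicity in the
-- environment is proved simultaneously (needed to interpret λ).
mutual
  ⟦_⟧ : ∀ {Γ σ} → Tm Γ σ → Env Γ → O σ
  ⟦ var x ⟧ ρ   = lookupEnv ρ x
  ⟦ lam t ⟧ ρ   = (λ d → ⟦ t ⟧ (d ∷ ρ)) , (λ p → ⟦⟧-mono t (p ∷ LeEnv-refl ρ))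
  ⟦ app t u ⟧ ρ = proj₁ (⟦ t ⟧ ρ) (⟦ u ⟧ ρ)
  ⟦ Ω σ ⟧ ρ     = bot σ

  ⟦⟧-mono : ∀ {Γ σ} (t : Tm Γ σ) {ρ ρ' : Env Γ} → LeEnv ρ ρ' → Le σ (⟦ t ⟧ ρ) (⟦ t ⟧ ρ')
  ⟦⟧-mono (var x) p = lookup-mono p x
  ⟦⟧-mono (lam t) p = λ d → ⟦⟧-mono t (Le-refl _ d ∷ p)
  ⟦⟧-mono (app {σ} {τ} t u) {ρ} {ρ'} p =
    Le-trans τ (proj₂ (⟦ t ⟧ ρ) (⟦⟧-mono u p)) (⟦⟧-mono t p (⟦ u ⟧ ρ'))
  ⟦⟧-mono (Ω σ) p = Le-refl σ (bot σ)

⟦_⟧₀ : ∀ {σ} → Tm [] σ → O σ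
⟦ M ⟧₀ = ⟦ M ⟧ []

-- Let pass σ ∈ O σ be given by pass o = ⊤ and pass (σ ⇒ τ) d = (pass τ if d
-- passes, ⊥ τ otherwise), where x passes when x applied to pass at every argument
-- type yields ⊤. In the environment sending every variable to pass, a neutral
-- term denotes pass if it is Ω-free and ⊥ otherwise; hence a long normal form is
-- proper exactly when its value passes. Every term is βη-convertible to a long
-- normal form (normalisation by evaluation) and convertible terms have equal
-- values, so having a proper normal form is a property of the value alone.
module Submission where

open import Defs
open import Data.Bool using (Bool; true; false)
open import Data.Empty using (⊥-elim)
open import Data.List using ([]; _∷_)
open import Data.Product using (_×_; _,_; proj₁; proj₂)
open import Data.Sum using (_⊎_; inj₁; inj₂)
open import Data.Unit using (tt)
open import Function.Bundles using (_⇔_; mk⇔; Equivalence)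
open import Function.Construct.Composition using (_⇔-∘_)
open import Function.Construct.Symmetry using (⇔-sym)
open import Relation.Nullary using (¬_)
import Relation.Binary.PropositionalEquality as ≡
open ≡ using (_≡_)

-- Renaming and substitution

rename-cong : ∀ {Γ Δ σ} {ρ ρ' : Ren Γ Δ} → (∀ {τ} (x : Γ ∋ τ) → ρ x ≡ ρ' x) →
              (t : Tm Γ σ) → rename ρ t ≡ rename ρ' t
rename-cong h (var x)   = ≡.cong var (h x)
rename-cong {ρ = ρ} {ρ'} h (lam t) = ≡.cong lam (rename-cong ext-cong t)
  where
  ext-cong : ∀ {τ σ} (x : (σ ∷ _) ∋ τ) → ext ρ x ≡ ext ρ' x
  ext-cong here      = ≡.refl
  ext-cong (there x) = ≡.cong there (h x)
rename-cong h (app t u) = ≡.cong₂ app (rename-cong h t) (rename-cong h u)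
rename-cong h (Ω σ)     = ≡.refl

subst-cong : ∀ {Γ Δ σ} {s s' : Sub Γ Δ} → (∀ {τ} (x : Γ ∋ τ) → s x ≡ s' x) →
             (t : Tm Γ σ) → subst s t ≡ subst s' t
subst-cong h (var x)   = h x
subst-cong {s = s} {s'} h (lam t) = ≡.cong lam (subst-cong exts-cong t)
  where
  exts-cong : ∀ {τ σ} (x : (σ ∷ _) ∋ τ) → exts s x ≡ exts s' x
  exts-cong here      = ≡.refl
  exts-cong (there x) = ≡.cong (rename there) (h x)
subst-cong h (app t u) = ≡.cong₂ app (subst-cong h t) (subst-cong h u)
subst-cong h (Ω σ)     = ≡.refl

rename-rename : ∀ {Γ Δ Θ σ} (ρ : Ren Γ Δ) (ρ' : Ren Δ Θ) (t : Tm Γ σ) →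
                rename ρ' (rename ρ t) ≡ rename (λ x → ρ' (ρ x)) t
rename-rename ρ ρ' (var x)   = ≡.refl
rename-rename ρ ρ' (lam t)   =
  ≡.cong lam (≡.trans (rename-rename (ext ρ) (ext ρ') t) (rename-cong ext-ext t))
  where
  ext-ext : ∀ {τ σ} (x : (σ ∷ _) ∋ τ) → ext ρ' (ext ρ x) ≡ ext (λ y → ρ' (ρ y)) x
  ext-ext here      = ≡.refl
  ext-ext (there x) = ≡.refl
rename-rename ρ ρ' (app t u) = ≡.cong₂ app (rename-rename ρ ρ' t) (rename-rename ρ ρ' u)
rename-rename ρ ρ' (Ω σ)     = ≡.refl

rename-id : ∀ {Γ σ} (t : Tm Γ σ) → rename (λ x → x) t ≡ t
rename-id (var x)   = ≡.refl
rename-id (lam t)   = ≡.cong lam (≡.trans (rename-cong ext-id t) (rename-id t))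
  where
  ext-id : ∀ {τ σ} (x : (σ ∷ _) ∋ τ) → ext (λ y → y) x ≡ x
  ext-id here      = ≡.refl
  ext-id (there x) = ≡.refl
rename-id (app t u) = ≡.cong₂ app (rename-id t) (rename-id u)
rename-id (Ω σ)     = ≡.refl

rename-subst : ∀ {Γ Δ Θ σ} (s : Sub Γ Δ) (ρ : Ren Δ Θ) (t : Tm Γ σ) →
               rename ρ (subst s t) ≡ subst (λ x → rename ρ (s x)) t
rename-subst s ρ (var x)   = ≡.refl
rename-subst s ρ (lam t)   =
  ≡.cong lam (≡.trans (rename-subst (exts s) (ext ρ) t) (subst-cong ext-exts t))
  where
  ext-exts : ∀ {τ σ} (x : (σ ∷ _) ∋ τ) →
             rename (ext ρ) (exts s x) ≡ exts (λ y → rename ρ (s y)) x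
  ext-exts here      = ≡.refl
  ext-exts (there x) =
    ≡.trans (rename-rename there (ext ρ) (s x)) (≡.sym (rename-rename ρ there (s x)))
rename-subst s ρ (app t u) = ≡.cong₂ app (rename-subst s ρ t) (rename-subst s ρ u)
rename-subst s ρ (Ω σ)     = ≡.refl

subst-rename : ∀ {Γ Δ Θ σ} (ρ : Ren Γ Δ) (s : Sub Δ Θ) (t : Tm Γ σ) →
               subst s (rename ρ t) ≡ subst (λ x → s (ρ x)) t
subst-rename ρ s (var x)   = ≡.refl
subst-rename ρ s (lam t)   =
  ≡.cong lam (≡.trans (subst-rename (ext ρ) (exts s) t) (subst-cong exts-ext t))
  where
  exts-ext : ∀ {τ σ} (x : (σ ∷ _) ∋ τ) → exts s (ext ρ x) ≡ exts (λ y → s (ρ y)) x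
  exts-ext here      = ≡.refl
  exts-ext (there x) = ≡.refl
subst-rename ρ s (app t u) = ≡.cong₂ app (subst-rename ρ s t) (subst-rename ρ s u)
subst-rename ρ s (Ω σ)     = ≡.refl

subst-subst : ∀ {Γ Δ Θ σ} (s : Sub Γ Δ) (s' : Sub Δ Θ) (t : Tm Γ σ) →
              subst s' (subst s t) ≡ subst (λ x → subst s' (s x)) t
subst-subst s s' (var x)   = ≡.refl
subst-subst s s' (lam t)   =
  ≡.cong lam (≡.trans (subst-subst (exts s) (exts s') t) (subst-cong exts-exts t))
  where
  exts-exts : ∀ {τ σ} (x : (σ ∷ _) ∋ τ) →
              subst (exts s') (exts s x) ≡ exts (λ y → subst s' (s y)) x
  exts-exts here      = ≡.refl
  exts-exts (there x) =
    ≡.trans (subst-rename there (exts s') (s x)) (≡.sym (rename-subst s' there (s x)))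
subst-subst s s' (app t u) = ≡.cong₂ app (subst-subst s s' t) (subst-subst s s' u)
subst-subst s s' (Ω σ)     = ≡.refl

subst-var∘ : ∀ {Γ Δ σ} (ρ : Ren Γ Δ) (t : Tm Γ σ) → subst (λ x → var (ρ x)) t ≡ rename ρ t
subst-var∘ ρ (var x)   = ≡.refl
subst-var∘ ρ (lam t)   = ≡.cong lam (≡.trans (subst-cong exts-var t) (subst-var∘ (ext ρ) t))
  where
  exts-var : ∀ {τ σ} (x : (σ ∷ _) ∋ τ) → exts (λ y → var (ρ y)) x ≡ var (ext ρ x)
  exts-var here      = ≡.refl
  exts-var (there x) = ≡.refl
subst-var∘ ρ (app t u) = ≡.cong₂ app (subst-var∘ ρ t) (subst-var∘ ρ u)
subst-var∘ ρ (Ω σ)     = ≡.refl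

subst-id : ∀ {Γ σ} (t : Tm Γ σ) → subst var t ≡ t
subst-id t = ≡.trans (subst-var∘ (λ x → x) t) (rename-id t)

rename-[] : ∀ {Γ Δ σ τ} (ρ : Ren Γ Δ) (t : Tm (σ ∷ Γ) τ) (u : Tm Γ σ) →
            rename ρ (t [ u ]) ≡ rename (ext ρ) t [ rename ρ u ]
rename-[] ρ t u = ≡.trans (rename-subst (single u) ρ t)
  (≡.trans (subst-cong single-ext t) (≡.sym (subst-rename (ext ρ) (single (rename ρ u)) t)))
  where
  single-ext : ∀ {τ} (x : _ ∋ τ) → rename ρ (single u x) ≡ single (rename ρ u) (ext ρ x)
  single-ext here      = ≡.refl
  single-ext (there x) = ≡.refl

≡⇒≡βη : ∀ {Γ σ} {t u : Tm Γ σ} → t ≡ u → t ≡βη u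
≡⇒≡βη ≡.refl = refl

rename-≡βη : ∀ {Γ Δ σ} (ρ : Ren Γ Δ) {t u : Tm Γ σ} → t ≡βη u → rename ρ t ≡βη rename ρ u
rename-≡βη ρ (β t u)     =
  trans (β (rename (ext ρ) t) (rename ρ u)) (≡⇒≡βη (≡.sym (rename-[] ρ t u)))
rename-≡βη ρ (η t)       = trans (η (rename ρ t)) (≡⇒≡βη (≡.cong (λ z → lam (app z (var here)))
  (≡.trans (rename-rename ρ there t) (≡.sym (rename-rename there (ext ρ) t)))))
rename-≡βη ρ refl        = refl
rename-≡βη ρ (sym p)     = sym (rename-≡βη ρ p)
rename-≡βη ρ (trans p q) = trans (rename-≡βη ρ p) (rename-≡βη ρ q)
rename-≡βη ρ (ξ p)       = ξ (rename-≡βη (ext ρ) p)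
rename-≡βη ρ (appc p q)  = appc (rename-≡βη ρ p) (rename-≡βη ρ q)

-- Normalisation by evaluation

mutual
  renameNf : ∀ {Γ Δ σ} → Ren Γ Δ → Nf Γ σ → Nf Δ σ
  renameNf ρ (lam n) = lam (renameNf (ext ρ) n)
  renameNf ρ (ne e)  = ne (renameNe ρ e)

  renameNe : ∀ {Γ Δ σ} → Ren Γ Δ → Ne Γ σ → Ne Δ σ
  renameNe ρ (var x)   = var (ρ x)
  renameNe ρ (Ω σ)     = Ω σ
  renameNe ρ (app e n) = app (renameNe ρ e) (renameNf ρ n)

mutual
  rename-⌜⌝ : ∀ {Γ Δ σ} (ρ : Ren Γ Δ) (n : Nf Γ σ) → rename ρ ⌜ n ⌝ ≡ ⌜ renameNf ρ n ⌝
  rename-⌜⌝ ρ (lam n) = ≡.cong lam (rename-⌜⌝ (ext ρ) n)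
  rename-⌜⌝ ρ (ne e)  = rename-⌜⌝ne ρ e

  rename-⌜⌝ne : ∀ {Γ Δ σ} (ρ : Ren Γ Δ) (e : Ne Γ σ) → rename ρ ⌜ e ⌝ne ≡ ⌜ renameNe ρ e ⌝ne
  rename-⌜⌝ne ρ (var x)   = ≡.refl
  rename-⌜⌝ne ρ (Ω σ)     = ≡.refl
  rename-⌜⌝ne ρ (app e n) = ≡.cong₂ app (rename-⌜⌝ne ρ e) (rename-⌜⌝ ρ n)

Val : Ctx → Ty → Set
Val Γ o       = Nf Γ o
Val Γ (σ ⇒ τ) = ∀ {Δ} → Ren Γ Δ → Val Δ σ → Val Δ τ

renameVal : ∀ {Γ Δ} σ → Ren Γ Δ → Val Γ σ → Val Δ σ
renameVal o       ρ n = renameNf ρ n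
renameVal (σ ⇒ τ) ρ f = λ ρ' → f (λ x → ρ' (ρ x))

mutual
  reflect : ∀ {Γ} σ → Ne Γ σ → Val Γ σ
  reflect o       e = ne e
  reflect (σ ⇒ τ) e = λ ρ v → reflect τ (app (renameNe ρ e) (reify σ v))

  reify : ∀ {Γ} σ → Val Γ σ → Nf Γ σ
  reify o       v = v
  reify (σ ⇒ τ) f = lam (reify τ (f there (reflect σ (var here))))

ValEnv : Ctx → Ctx → Set
ValEnv Γ Δ = ∀ {σ} → Γ ∋ σ → Val Δ σ

_∷ᵥ_ : ∀ {Γ Δ σ} → Val Δ σ → ValEnv Γ Δ → ValEnv (σ ∷ Γ) Δ
(v ∷ᵥ γ) here      = v
(v ∷ᵥ γ) (there x) = γ x

_∷ₛ_ : ∀ {Γ Δ σ} → Tm Δ σ → Sub Γ Δ → Sub (σ ∷ Γ) Δ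
(u ∷ₛ s) here      = u
(u ∷ₛ s) (there x) = s x

eval : ∀ {Γ Δ σ} → Tm Γ σ → ValEnv Γ Δ → Val Δ σ
eval (var x)   γ = γ x
eval (lam t)   γ = λ ρ v → eval t (v ∷ᵥ (λ x → renameVal _ ρ (γ x)))
eval (app t u) γ = eval t γ (λ x → x) (eval u γ)
eval (Ω σ)     γ = reflect σ (Ω σ)

reflectVars : ∀ {Γ} → ValEnv Γ Γ
reflectVars x = reflect _ (var x)

nf : ∀ {Γ σ} → Tm Γ σ → Nf Γ σ
nf {σ = σ} t = reify σ (eval t reflectVars)

Tracks : ∀ {Γ} σ → Tm Γ σ → Val Γ σ → Set
Tracks o       t v = t ≡βη ⌜ v ⌝
Tracks {Γ} (σ ⇒ τ) t f =
  ∀ {Δ} (ρ : Ren Γ Δ) {u v} → Tracks σ u v → Tracks τ (app (rename ρ t) u) (f ρ v)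

Tracks-≡βη : ∀ {Γ} σ {t t' : Tm Γ σ} {v} → t ≡βη t' → Tracks σ t' v → Tracks σ t v
Tracks-≡βη o       p r = trans p r
Tracks-≡βη (σ ⇒ τ) p r = λ ρ q → Tracks-≡βη τ (appc (rename-≡βη ρ p) refl) (r ρ q)

Tracks-rename : ∀ {Γ Δ} σ (ρ : Ren Γ Δ) {t v} → Tracks σ t v → Tracks σ (rename ρ t) (renameVal σ ρ v)
Tracks-rename o       ρ {v = n} r = ≡.subst (rename ρ _ ≡βη_) (rename-⌜⌝ ρ n) (rename-≡βη ρ r)
Tracks-rename (σ ⇒ τ) ρ {t} {f} r = λ ρ' {u} {v} q →
  ≡.subst (λ z → Tracks τ (app z u) (f (λ x → ρ' (ρ x)) v))
          (≡.sym (rename-rename ρ ρ' t)) (r (λ x → ρ' (ρ x)) q)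

mutual
  reflect-Tracks : ∀ {Γ} σ {t : Tm Γ σ} (e : Ne Γ σ) → t ≡βη ⌜ e ⌝ne → Tracks σ t (reflect σ e)
  reflect-Tracks o       e p = p
  reflect-Tracks (σ ⇒ τ) e p = λ ρ q → reflect-Tracks τ _
    (appc (≡.subst (rename ρ _ ≡βη_) (rename-⌜⌝ne ρ e) (rename-≡βη ρ p)) (reify-Tracks σ q))

  reify-Tracks : ∀ {Γ} σ {t : Tm Γ σ} {v} → Tracks σ t v → t ≡βη ⌜ reify σ v ⌝
  reify-Tracks o       r = r
  reify-Tracks (σ ⇒ τ) r =
    trans (η _) (ξ (reify-Tracks τ (r there (reflect-Tracks σ (var here) refl))))

[]-rename-subst : ∀ {Γ Δ Θ σ τ} (s : Sub Γ Δ) (ρ : Ren Δ Θ) (t : Tm (σ ∷ Γ) τ) (u : Tm Θ σ) →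
                  rename (ext ρ) (subst (exts s) t) [ u ] ≡ subst (u ∷ₛ (λ x → rename ρ (s x))) t
[]-rename-subst s ρ t u = ≡.trans (subst-rename (ext ρ) (single u) (subst (exts s) t))
  (≡.trans (subst-subst (exts s) _ t) (subst-cong single-ext-exts t))
  where
  single-ext-exts : ∀ {τ} (x : _ ∋ τ) →
    subst (λ y → single u (ext ρ y)) (exts s x) ≡ (u ∷ₛ (λ y → rename ρ (s y))) x
  single-ext-exts here      = ≡.refl
  single-ext-exts (there x) = ≡.trans (subst-rename there _ (s x)) (subst-var∘ ρ (s x))

eval-Tracks : ∀ {Γ Δ σ} (t : Tm Γ σ) {s : Sub Γ Δ} {γ : ValEnv Γ Δ} →
              (∀ {τ} (x : Γ ∋ τ) → Tracks τ (s x) (γ x)) → Tracks σ (subst s t) (eval t γ)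
eval-Tracks (var x)   h = h x
eval-Tracks (Ω σ)     h = reflect-Tracks σ (Ω σ) refl
eval-Tracks (app {τ = τ} t u) {s} {γ} h =
  ≡.subst (λ z → Tracks τ (app z (subst s u)) (eval t γ (λ x → x) (eval u γ)))
          (rename-id (subst s t)) (eval-Tracks t h (λ x → x) (eval-Tracks u h))
eval-Tracks (lam {τ = τ} t) {s} {γ} h = λ ρ {u} q →
  Tracks-≡βη τ (trans (β _ u) (≡⇒≡βη ([]-rename-subst s ρ t u))) (eval-Tracks t (extend ρ q))
  where
  extend : ∀ {Θ σ} (ρ : Ren _ Θ) {u v} → Tracks σ u v → ∀ {τ'} (x : (σ ∷ _) ∋ τ') →
           Tracks τ' ((u ∷ₛ (λ y → rename ρ (s y))) x) ((v ∷ᵥ (λ y → renameVal _ ρ (γ y))) x)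
  extend ρ q here      = q
  extend ρ q (there x) = Tracks-rename _ ρ (h x)

≡βη-nf : ∀ {Γ σ} (t : Tm Γ σ) → t ≡βη ⌜ nf t ⌝
≡βη-nf {σ = σ} t = reify-Tracks σ (≡.subst (λ z → Tracks σ z (eval t reflectVars)) (subst-id t) tracks)
  where
  tracks : Tracks σ (subst var t) (eval t reflectVars)
  tracks = eval-Tracks t (λ x → reflect-Tracks _ (var x) refl)

-- Soundness of the monotone model

SemEq-refl : ∀ σ (x : O σ) → SemEq σ x x
SemEq-refl o       x = ≡.refl
SemEq-refl (σ ⇒ τ) f = λ d → SemEq-refl τ (proj₁ f d)

SemEq-sym : ∀ σ {x y : O σ} → SemEq σ x y → SemEq σ y x
SemEq-sym o       p = ≡.sym p
SemEq-sym (σ ⇒ τ) p = λ d → SemEq-sym τ (p d)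

SemEq-trans : ∀ σ {x y z : O σ} → SemEq σ x y → SemEq σ y z → SemEq σ x z
SemEq-trans o       p q = ≡.trans p q
SemEq-trans (σ ⇒ τ) p q = λ d → SemEq-trans τ (p d) (q d)

SemEq⇒Le : ∀ σ {x y : O σ} → SemEq σ x y → Le σ x y
SemEq⇒Le o       ≡.refl = Le-refl o _
SemEq⇒Le (σ ⇒ τ) p      = λ d → SemEq⇒Le τ (p d)

Le-antisym : ∀ σ {x y : O σ} → Le σ x y → Le σ y x → SemEq σ x y
Le-antisym o {false} {false} p q = ≡.refl
Le-antisym o {true}  {true}  p q = ≡.refl
Le-antisym o {true}  {false} ()
Le-antisym (σ ⇒ τ) p q = λ d → Le-antisym τ (p d) (q d)

lookupEnv-SemEq-refl : ∀ {Γ} (e : Env Γ) {τ} (x : Γ ∋ τ) → SemEq τ (lookupEnv e x) (lookupEnv e x)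
lookupEnv-SemEq-refl e {τ} x = SemEq-refl τ (lookupEnv e x)

-- SemEq compares functions only pointwise; monotonicity lets it respect SemEq arguments.
SemEq-app : ∀ σ τ {f g : O (σ ⇒ τ)} {x y : O σ} → SemEq (σ ⇒ τ) f g → SemEq σ x y →
            SemEq τ (proj₁ f x) (proj₁ g y)
SemEq-app σ τ {f} p q = SemEq-trans τ
  (Le-antisym τ (proj₂ f (SemEq⇒Le σ q)) (proj₂ f (SemEq⇒Le σ (SemEq-sym σ q)))) (p _)

⟦rename⟧ : ∀ {Γ Δ σ} (t : Tm Γ σ) (ρ : Ren Γ Δ) {e : Env Γ} {e' : Env Δ} →
           (∀ {τ} (x : Γ ∋ τ) → SemEq τ (lookupEnv e x) (lookupEnv e' (ρ x))) →
           SemEq σ (⟦ t ⟧ e) (⟦ rename ρ t ⟧ e')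
⟦rename⟧ (var x)           ρ h = h x
⟦rename⟧ (Ω σ)             ρ h = SemEq-refl σ (bot σ)
⟦rename⟧ (app {σ} {τ} t u) ρ {e} {e'} h =
  SemEq-app σ τ {⟦ t ⟧ e} {⟦ rename ρ t ⟧ e'} (⟦rename⟧ t ρ h) (⟦rename⟧ u ρ h)
⟦rename⟧ (lam {σ} t)       ρ {e} {e'} h = λ d → ⟦rename⟧ t (ext ρ) (extend d)
  where
  extend : ∀ d {τ} (x : (σ ∷ _) ∋ τ) → SemEq τ (lookupEnv (d ∷ e) x) (lookupEnv (d ∷ e') (ext ρ x))
  extend d here      = SemEq-refl σ d
  extend d (there x) = h x

⟦subst⟧ : ∀ {Γ Δ σ} (t : Tm Γ σ) (s : Sub Γ Δ) {e : Env Γ} {e' : Env Δ} →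
          (∀ {τ} (x : Γ ∋ τ) → SemEq τ (lookupEnv e x) (⟦ s x ⟧ e')) →
          SemEq σ (⟦ t ⟧ e) (⟦ subst s t ⟧ e')
⟦subst⟧ (var x)           s h = h x
⟦subst⟧ (Ω σ)             s h = SemEq-refl σ (bot σ)
⟦subst⟧ (app {σ} {τ} t u) s {e} {e'} h =
  SemEq-app σ τ {⟦ t ⟧ e} {⟦ subst s t ⟧ e'} (⟦subst⟧ t s h) (⟦subst⟧ u s h)
⟦subst⟧ (lam {σ} t)       s {e} {e'} h = λ d → ⟦subst⟧ t (exts s) (extend d)
  where
  extend : ∀ d {τ} (x : (σ ∷ _) ∋ τ) → SemEq τ (lookupEnv (d ∷ e) x) (⟦ exts s x ⟧ (d ∷ e'))
  extend d here              = SemEq-refl σ d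
  extend d (there {σ = τ} x) =
    SemEq-trans τ (h x) (⟦rename⟧ (s x) there (lookupEnv-SemEq-refl e'))

⟦⟧-≡βη : ∀ {Γ σ} {t u : Tm Γ σ} → t ≡βη u → (e : Env Γ) → SemEq σ (⟦ t ⟧ e) (⟦ u ⟧ e)
⟦⟧-≡βη (β {σ} t u) e = ⟦subst⟧ t (single u) ⟦single⟧
  where
  ⟦single⟧ : ∀ {τ} (x : (σ ∷ _) ∋ τ) → SemEq τ (lookupEnv (⟦ u ⟧ e ∷ e) x) (⟦ single u x ⟧ e)
  ⟦single⟧ here      = SemEq-refl σ (⟦ u ⟧ e)
  ⟦single⟧ (there x) = lookupEnv-SemEq-refl e x
⟦⟧-≡βη (η t)               e = λ d → ⟦rename⟧ t there (lookupEnv-SemEq-refl e) d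
⟦⟧-≡βη {σ = σ} refl        e = SemEq-refl σ _
⟦⟧-≡βη {σ = σ} (sym p)     e = SemEq-sym σ (⟦⟧-≡βη p e)
⟦⟧-≡βη {σ = σ} (trans p q) e = SemEq-trans σ (⟦⟧-≡βη p e) (⟦⟧-≡βη q e)
⟦⟧-≡βη (ξ p)               e = λ d → ⟦⟧-≡βη p (d ∷ e)
⟦⟧-≡βη (appc {σ} {τ} {t} {t'} p q) e =
  SemEq-app σ τ {⟦ t ⟧ e} {⟦ t' ⟧ e} (⟦⟧-≡βη p e) (⟦⟧-≡βη q e)

-- Testing for Ω

bot-least : ∀ σ (x : O σ) → Le σ (bot σ) x
bot-least o       x = tt
bot-least (σ ⇒ τ) f = λ d → bot-least τ (proj₁ f d)

mutual
  test : ∀ σ → O σ → Bool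
  test o       b = b
  test (σ ⇒ τ) f = test τ (proj₁ f (pass σ))

  pass : ∀ σ → O σ
  pass o       = true
  pass (σ ⇒ τ) = (λ d → guard τ (test σ d)) , (λ p → guard-mono τ (test-mono σ p))

  guard : ∀ τ → Bool → O τ
  guard τ true  = pass τ
  guard τ false = bot τ

  guard-mono : ∀ τ {a b : Bool} → Le o a b → Le τ (guard τ a) (guard τ b)
  guard-mono τ {false} p = bot-least τ _
  guard-mono τ {true} {true} p = Le-refl τ (pass τ)

  test-mono : ∀ σ {x y : O σ} → Le σ x y → Le o (test σ x) (test σ y)
  test-mono o       p = p
  test-mono (σ ⇒ τ) p = test-mono τ (p (pass σ))

test-cong : ∀ σ {x y : O σ} → SemEq σ x y → test σ x ≡ test σ y
test-cong o       p = p
test-cong (σ ⇒ τ) p = test-cong τ (p (pass σ))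

passEnv : ∀ Γ → Env Γ
passEnv []      = []
passEnv (σ ∷ Γ) = pass σ ∷ passEnv Γ

lookup-passEnv : ∀ {Γ σ} (x : Γ ∋ σ) → lookupEnv (passEnv Γ) x ≡ pass σ
lookup-passEnv here      = ≡.refl
lookup-passEnv (there x) = lookup-passEnv x

apply-to : ∀ {σ τ} {f g : O (σ ⇒ τ)} (x : O σ) → f ≡ g → proj₁ f x ≡ proj₁ g x
apply-to x = ≡.cong (λ f → proj₁ f x)

mutual
  nf-dichotomy : ∀ {Γ σ} (n : Nf Γ σ) →
    (ProperNf n × test σ (⟦ ⌜ n ⌝ ⟧ (passEnv Γ)) ≡ true) ⊎
    (¬ ProperNf n × test σ (⟦ ⌜ n ⌝ ⟧ (passEnv Γ)) ≡ false)
  nf-dichotomy (lam n) = nf-dichotomy n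
  nf-dichotomy (ne e)  = ne-dichotomy e

  ne-dichotomy : ∀ {Γ σ} (e : Ne Γ σ) →
    (ProperNe e × ⟦ ⌜ e ⌝ne ⟧ (passEnv Γ) ≡ pass σ) ⊎
    (¬ ProperNe e × ⟦ ⌜ e ⌝ne ⟧ (passEnv Γ) ≡ bot σ)
  ne-dichotomy (var x) = inj₁ (tt , lookup-passEnv x)
  ne-dichotomy (Ω σ)   = inj₂ ((λ ()) , ≡.refl)
  ne-dichotomy {Γ} (app {τ = τ} e n) with ne-dichotomy e | nf-dichotomy n
  ... | inj₁ (pe , ⟦e⟧) | inj₁ (pn , ⟦n⟧) =
    inj₁ ((pe , pn) , ≡.trans (apply-to _ ⟦e⟧) (≡.cong (guard τ) ⟦n⟧))
  ... | inj₁ (_ , ⟦e⟧)  | inj₂ (¬pn , ⟦n⟧) =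
    inj₂ ((λ p → ¬pn (proj₂ p)) , ≡.trans (apply-to _ ⟦e⟧) (≡.cong (guard τ) ⟦n⟧))
  ... | inj₂ (¬pe , ⟦e⟧) | _ =
    inj₂ ((λ p → ¬pe (proj₁ p)) , apply-to _ ⟦e⟧)

ProperNf⇔test : ∀ {Γ σ} (n : Nf Γ σ) → ProperNf n ⇔ (test σ (⟦ ⌜ n ⌝ ⟧ (passEnv Γ)) ≡ true)
ProperNf⇔test n = mk⇔ to from
  where
  to : ProperNf n → _ ≡ true
  to p with nf-dichotomy n
  ... | inj₁ (_ , passes) = passes
  ... | inj₂ (¬p , _)     = ⊥-elim (¬p p)

  from : _ ≡ true → ProperNf n
  from passes with nf-dichotomy n
  ... | inj₁ (p , _)     = p
  ... | inj₂ (_ , fails) with ≡.trans (≡.sym fails) passes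
  ...   | ()

HasProperNF⇔test : ∀ {Γ σ} (M : Tm Γ σ) → HasProperNF M ⇔ (test σ (⟦ M ⟧ (passEnv Γ)) ≡ true)
HasProperNF⇔test {Γ} {σ} M = mk⇔ to from
  where
  test-≡βη : ∀ {N} → M ≡βη N → test σ (⟦ M ⟧ (passEnv Γ)) ≡ test σ (⟦ N ⟧ (passEnv Γ))
  test-≡βη M≡N = test-cong σ (⟦⟧-≡βη M≡N (passEnv Γ))

  to : HasProperNF M → _ ≡ true
  to (n , p , M≡n) = ≡.trans (test-≡βη M≡n) (Equivalence.to (ProperNf⇔test n) p)

  from : _ ≡ true → HasProperNF M
  from passes = nf M , Equivalence.from (ProperNf⇔test (nf M)) nf-passes , ≡βη-nf M
    where
    nf-passes : test σ (⟦ ⌜ nf M ⌝ ⟧ (passEnv Γ)) ≡ true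
    nf-passes = ≡.trans (≡.sym (test-≡βη (≡βη-nf M))) passes

lemma5 : ∀ {σ : Ty} (M N : Tm [] σ) →
         SemEq σ ⟦ M ⟧₀ ⟦ N ⟧₀ →
         (HasProperNF M ⇔ HasProperNF N)
lemma5 {σ} M N M≈N = ⇔-sym (HasProperNF⇔test N) ⇔-∘ (same-test ⇔-∘ HasProperNF⇔test M)
  where
  same-test : (test σ ⟦ M ⟧₀ ≡ true) ⇔ (test σ ⟦ N ⟧₀ ≡ true)
  same-test = mk⇔ (≡.trans (≡.sym (test-cong σ M≈N))) (≡.trans (test-cong σ M≈N))
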